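{- Let $G$ be a connected graph, let $uv\in E(G)$, and let $G'$ be the graph obtained from $G$ by subdividing the edge $uv$ three times (i.e., replacing the edge $uv$ by a path $u x_1 x_2 x_3 v$, where $x_1,x_2,x_3$ are new vertices). If $\gamma^{d}_2(G)\leq \frac{|V(G)|}{3}$, then $\gamma^{d}_2(G')\leq \frac{|V(G')|}{3}$.
   Context: All graphs are finite and simple. A set $S$ of vertices of a graph $G$ is a disjunctive dominating set ($2DD$-set) of $G$ if every vertex not in $S$ is adjacent to a vertex of $S$ or has at least two vertices of $S$ at distance exactly $2$ from it in $G$. The disjunctive domination number $\gamma^{d}_2(G)$ is the minimum cardinality of a disjunctive dominating set of $G$. -}

module Defs where

open import Data.Nat using (ℕ; _+_; _*_; _≤_)
open import Data.Bool using (Bool; true; false; _∧_; _∨_)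
open import Data.Fin using (Fin; zero; suc; splitAt)
open import Data.Fin.Properties using (_≟_)
open import Data.Fin.Subset using (Subset; _∈_; ∣_∣)
open import Data.Sum using (_⊎_; inj₁; inj₂)
open import Data.Product using (_×_; ∃; ∃-syntax)
open import Relation.Nullary using (¬_)
open import Relation.Nullary.Decidable using (⌊_⌋)
open import Relation.Binary.PropositionalEquality using (_≡_; _≢_)

AdjFun : ℕ → Set
AdjFun n = Fin n → Fin n → Bool

record IsSimple {n : ℕ} (G : AdjFun n) : Set where
  field
    sym    : ∀ x y → G x y ≡ G y x
    irrefl : ∀ x → G x x ≡ false

Adj : ∀ {n} → AdjFun n → Fin n → Fin n → Set
Adj G x y = G x y ≡ true

data Walk {n : ℕ} (G : AdjFun n) : Fin n → Fin n → Set where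
  [] : ∀ {x} → Walk G x x
  _∷_ : ∀ {x y z} → Adj G x y → Walk G y z → Walk G x z

Connected : ∀ {n} → AdjFun n → Set
Connected {n} G = ∀ (x y : Fin n) → Walk G x y

Dist2 : ∀ {n} → AdjFun n → Fin n → Fin n → Set
Dist2 G x y = x ≢ y × ¬ Adj G x y × ∃[ w ] (Adj G x w × Adj G w y)

Is2DD : ∀ {n} → AdjFun n → Subset n → Set
Is2DD {n} G S = ∀ (x : Fin n) → ¬ (x ∈ S) →
  (∃[ y ] (y ∈ S × Adj G x y))
  ⊎ (∃[ y ] ∃[ z ] (y ≢ z × y ∈ S × z ∈ S × Dist2 G x y × Dist2 G x z))

IsDDNumber : ∀ {n} → AdjFun n → ℕ → Set
IsDDNumber {n} G k =
  (∃[ S ] (Is2DD G S × ∣ S ∣ ≡ k)) × (∀ (S : Subset n) → Is2DD G S → k ≤ ∣ S ∣)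

-- Subdividing edge uv three times: vertex set Fin (n + 3); the first n
-- vertices are the old ones, the last three are x₁ x₂ x₃ (indices 0,1,2).
eqb : ∀ {n} → Fin n → Fin n → Bool
eqb a b = ⌊ a ≟ b ⌋

pathAdj : Fin 3 → Fin 3 → Bool
pathAdj zero (suc zero) = true
pathAdj (suc zero) zero = true
pathAdj (suc zero) (suc (suc zero)) = true
pathAdj (suc (suc zero)) (suc zero) = true
pathAdj _ _ = false

oldNew : ∀ {n} → Fin n → Fin n → Fin n → Fin 3 → Bool
oldNew u v a zero = eqb a u
oldNew u v a (suc (suc zero)) = eqb a v
oldNew u v a _ = false

isUV : ∀ {n} → Fin n → Fin n → Fin n → Fin n → Bool
isUV u v a b = (eqb a u ∧ eqb b v) ∨ (eqb a v ∧ eqb b u)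

subAdj : ∀ {n} → AdjFun n → Fin n → Fin n → Fin n ⊎ Fin 3 → Fin n ⊎ Fin 3 → Bool
subAdj G u v (inj₁ a) (inj₁ b) with isUV u v a b
... | true = false
... | false = G a b
subAdj G u v (inj₁ a) (inj₂ i) = oldNew u v a i
subAdj G u v (inj₂ i) (inj₁ a) = oldNew u v a i
subAdj G u v (inj₂ i) (inj₂ j) = pathAdj i j

subdivide3 : ∀ {n} → AdjFun n → Fin n → Fin n → AdjFun (n + 3)
subdivide3 {n} G u v x y = subAdj G u v (splitAt n x) (splitAt n y)

{-# OPTIONS --safe #-}
-- Adding a single one of the new vertices x₁, x₂, x₃ to a disjunctive
-- dominating set S of G gives one of G′, so γ(G′) ≤ γ(G) + 1 and hence
-- 3γ(G′) ≤ |V(G)| + 3.  Only the edge uv disappears, so the vertices at risk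
-- are the endpoints and the neighbours of one endpoint that relied on the
-- other at distance two.  If v ∉ S and u is in S or has a neighbour in S, x₃
-- repairs everything; symmetrically x₁; otherwise either both endpoints are
-- in S or neither is and neither has a neighbour in S, and x₂ works.  The x₁
-- case is the x₃ case for the reversed edge vu, transported along x₁ ↔ x₃.
module Submission where

open import Defs
open import Data.Nat using (ℕ; _+_; _*_; _≤_)
open import Data.Nat.Properties using (*-monoʳ-≤; *-distribˡ-+; +-monoˡ-≤; module ≤-Reasoning)
open import Data.Bool using (true; false; _∧_)
import Data.Bool as Bool
open import Data.Bool.Properties using (T-≡; ∨-comm)
open import Data.Fin using (Fin; zero; suc; splitAt; join; opposite)
open import Data.Fin.Properties using (_≟_; any?; splitAt-join; join-splitAt; opposite-involutive)
open import Data.Fin.Subset using (Subset; _∈_; _∉_; ∣_∣; ⁅_⁆)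
open import Data.Fin.Subset.Properties using (_∈?_; x∈⁅x⁆; ∣⁅x⁆∣≡1)
open import Data.Vec using (_∷_; []; _++_)
open import Data.Vec.Properties using (lookup-++ˡ; lookup-++ʳ; []=⇒lookup; lookup⇒[]=)
open import Data.Sum using (_⊎_; inj₁; inj₂; map₂)
open import Data.Product using (_×_; _,_; ∃-syntax)
open import Data.Empty using (⊥; ⊥-elim)
open import Function using (id; _⇔_; mk⇔; Equivalence)
open import Relation.Nullary using (¬_; yes; no; Dec; contradiction)
open import Relation.Nullary.Decidable using (_×-dec_; _⊎-dec_; fromWitness; toWitness)
open import Relation.Binary.PropositionalEquality

module _ {V : Set} (E : V → V → Set) where

  AtDistanceTwo : V → V → Set
  AtDistanceTwo x y = x ≢ y × ¬ E x y × ∃[ w ] (E x w × E w y)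

  DisjDominated : (V → Set) → V → Set
  DisjDominated P x = (∃[ y ] (P y × E x y))
    ⊎ (∃[ y ] ∃[ z ] (y ≢ z × P y × P z × AtDistanceTwo x y × AtDistanceTwo x z))

  DisjDominating : (V → Set) → Set
  DisjDominating P = ∀ x → ¬ P x → DisjDominated P x

module _ {V W : Set} {E : V → V → Set} {E′ : W → W → Set} {P : V → Set} {P′ : W → Set}
         (f : W → V) (g : V → W) (f∘g : ∀ y → f (g y) ≡ y)
         (adj : ∀ x y → E (f x) (f y) ⇔ E′ x y) (mem : ∀ x → P (f x) → P′ x) where

  private
    adj⁺ : ∀ x y → E (f x) y → E′ x (g y)
    adj⁺ x y e = Equivalence.to (adj x (g y)) (subst (E (f x)) (sym (f∘g y)) e)

    mem⁺ : ∀ y → P y → P′ (g y)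
    mem⁺ y p = mem (g y) (subst P (sym (f∘g y)) p)

    g-injective : ∀ {y z} → g y ≡ g z → y ≡ z
    g-injective {y} {z} e = trans (sym (f∘g y)) (trans (cong f e) (f∘g z))

    distanceTwo⁺ : ∀ x y → AtDistanceTwo E (f x) y → AtDistanceTwo E′ x (g y)
    distanceTwo⁺ x y (x≢y , ¬xy , w , xw , wy) =
      (λ x≡gy → x≢y (trans (cong f x≡gy) (f∘g y))) ,
      (λ xy → ¬xy (subst (E (f x)) (f∘g y) (Equivalence.from (adj x (g y)) xy))) ,
      g w , adj⁺ x w xw , adj⁺ (g w) y (subst (λ w′ → E w′ y) (sym (f∘g w)) wy)

  DisjDominated-pullback : ∀ x → DisjDominated E P (f x) → DisjDominated E′ P′ x
  DisjDominated-pullback x (inj₁ (y , Py , xy)) = inj₁ (g y , mem⁺ y Py , adj⁺ x y xy)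
  DisjDominated-pullback x (inj₂ (y , z , y≢z , Py , Pz , xy , xz)) =
    inj₂ (g y , g z , (λ e → y≢z (g-injective e)) , mem⁺ y Py , mem⁺ z Pz ,
          distanceTwo⁺ x y xy , distanceTwo⁺ x z xz)

  DisjDominating-pullback : DisjDominating E P → DisjDominating E′ P′
  DisjDominating-pullback dom x ¬P′x = DisjDominated-pullback x (dom (f x) (λ Pfx → ¬P′x (mem x Pfx)))

pattern i₁ = zero
pattern i₂ = suc zero
pattern i₃ = suc (suc zero)

pattern x₁ = inj₂ i₁
pattern x₂ = inj₂ i₂
pattern x₃ = inj₂ i₃

eqb-refl : ∀ {n} (a : Fin n) → eqb a a ≡ true
eqb-refl a = Equivalence.to T-≡ (fromWitness refl)

eqb⇒≡ : ∀ {n} {a b : Fin n} → eqb a b ≡ true → a ≡ b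
eqb⇒≡ e = toWitness (Equivalence.from T-≡ e)

∣p++q∣ : ∀ {m n} (p : Subset m) (q : Subset n) → ∣ p ++ q ∣ ≡ ∣ p ∣ + ∣ q ∣
∣p++q∣ []          q = refl
∣p++q∣ (true ∷ p)  q = cong ℕ.suc (∣p++q∣ p q)
∣p++q∣ (false ∷ p) q = ∣p++q∣ p q

Extend : ∀ {n} → Subset n → Fin 3 → Fin n ⊎ Fin 3 → Set
Extend S c (inj₁ a) = a ∈ S
Extend S c (inj₂ i) = i ≡ c

Extend⇒∈++ : ∀ {n} (S : Subset n) c x → Extend S c (splitAt n x) → x ∈ S ++ ⁅ c ⁆
Extend⇒∈++ {n} S c x m = subst (_∈ S ++ ⁅ c ⁆) (join-splitAt n 3 x) (joined (splitAt n x) m)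
  where
  joined : ∀ y → Extend S c y → join n 3 y ∈ S ++ ⁅ c ⁆
  joined (inj₁ a) a∈S  = lookup⇒[]= _ _ (trans (lookup-++ˡ S ⁅ c ⁆ a) ([]=⇒lookup a∈S))
  joined (inj₂ i) refl = lookup⇒[]= _ _ (trans (lookup-++ʳ S ⁅ i ⁆ i) ([]=⇒lookup (x∈⁅x⁆ i)))

HasNeighbourIn : ∀ {n} → AdjFun n → Subset n → Fin n → Set
HasNeighbourIn G S a = ∃[ y ] (y ∈ S × Adj G a y)

hasNeighbourIn? : ∀ {n} (G : AdjFun n) S a → Dec (HasNeighbourIn G S a)
hasNeighbourIn? G S a = any? λ y → y ∈? S ×-dec (G a y Bool.≟ true)

module Subdivision {n} (G : AdjFun n) (u v : Fin n) where

  _~_ : Fin n ⊎ Fin 3 → Fin n ⊎ Fin 3 → Set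
  x ~ y = subAdj G u v x y ≡ true

  IsUV : Fin n → Fin n → Set
  IsUV a b = (a ≡ u × b ≡ v) ⊎ (a ≡ v × b ≡ u)

  isUV? : ∀ a b → Dec (IsUV a b)
  isUV? a b = (a ≟ u ×-dec b ≟ v) ⊎-dec (a ≟ v ×-dec b ≟ u)

  isUV-false : ∀ {a b} → ¬ IsUV a b → isUV u v a b ≡ false
  isUV-false {a} {b} ¬uv with a ≟ u | b ≟ v | a ≟ v | b ≟ u
  ... | yes p | yes q | _     | _     = contradiction (inj₁ (p , q)) ¬uv
  ... | _     | _     | yes p | yes q = contradiction (inj₂ (p , q)) ¬uv
  ... | no _  | _     | no _  | _     = refl
  ... | no _  | _     | yes _ | no _  = refl
  ... | yes _ | no _  | no _  | _     = refl
  ... | yes _ | no _  | yes _ | no _  = refl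

  Adj⇒~ : ∀ {a b} → Adj G a b → ¬ IsUV a b → inj₁ a ~ inj₁ b
  Adj⇒~ ab ¬uv rewrite isUV-false ¬uv = ab

  ~⇒Adj : ∀ {a b} → inj₁ a ~ inj₁ b → Adj G a b
  ~⇒Adj {a} {b} with isUV u v a b
  ... | true  = λ ()
  ... | false = id

module _ {n} (G : AdjFun n) where

  mirror : Fin n ⊎ Fin 3 → Fin n ⊎ Fin 3
  mirror = map₂ opposite

  mirror-involutive : ∀ x → mirror (mirror x) ≡ x
  mirror-involutive (inj₁ a) = refl
  mirror-involutive (inj₂ i) = cong inj₂ (opposite-involutive i)

  subAdj-mirror : ∀ u v x y → subAdj G v u (mirror x) (mirror y) ≡ subAdj G u v x y
  subAdj-mirror u v (inj₁ a) (inj₁ b) rewrite ∨-comm (eqb a v ∧ eqb b u) (eqb a u ∧ eqb b v) = refl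
  subAdj-mirror u v (inj₁ a) (inj₂ i₁) = refl
  subAdj-mirror u v (inj₁ a) (inj₂ i₂) = refl
  subAdj-mirror u v (inj₁ a) (inj₂ i₃) = refl
  subAdj-mirror u v (inj₂ i₁) (inj₁ b) = refl
  subAdj-mirror u v (inj₂ i₂) (inj₁ b) = refl
  subAdj-mirror u v (inj₂ i₃) (inj₁ b) = refl
  subAdj-mirror u v (inj₂ i) (inj₂ j) = pathAdj-mirror i j
    where
    pathAdj-mirror : ∀ i j → pathAdj (opposite i) (opposite j) ≡ pathAdj i j
    pathAdj-mirror i₁ i₁ = refl
    pathAdj-mirror i₁ i₂ = refl
    pathAdj-mirror i₁ i₃ = refl
    pathAdj-mirror i₂ i₁ = refl
    pathAdj-mirror i₂ i₂ = refl
    pathAdj-mirror i₂ i₃ = refl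
    pathAdj-mirror i₃ i₁ = refl
    pathAdj-mirror i₃ i₂ = refl
    pathAdj-mirror i₃ i₃ = refl

  mirror-adj : ∀ u v x y → subAdj G v u (mirror x) (mirror y) ≡ true ⇔ subAdj G u v x y ≡ true
  mirror-adj u v x y = mk⇔ (trans (sym (subAdj-mirror u v x y))) (trans (subAdj-mirror u v x y))

  mirror-mem : ∀ S c x → Extend S (opposite c) (mirror x) → Extend S c x
  mirror-mem S c (inj₁ a) a∈S = a∈S
  mirror-mem S c (inj₂ i) e =
    trans (sym (opposite-involutive i)) (trans (cong opposite e) (opposite-involutive c))

  DisjDominated-mirror : ∀ {u v} S c x →
    DisjDominated (Subdivision._~_ G v u) (Extend S (opposite c)) (mirror x) →
    DisjDominated (Subdivision._~_ G u v) (Extend S c) x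
  DisjDominated-mirror {u} {v} S c =
    DisjDominated-pullback mirror mirror mirror-involutive (mirror-adj u v) (mirror-mem S c)

  DisjDominating-mirror : ∀ {u v} S c →
    DisjDominating (Subdivision._~_ G v u) (Extend S (opposite c)) →
    DisjDominating (Subdivision._~_ G u v) (Extend S c)
  DisjDominating-mirror {u} {v} S c =
    DisjDominating-pullback mirror mirror mirror-involutive (mirror-adj u v) (mirror-mem S c)

module Extension {n} {G : AdjFun n} (simple : IsSimple G) {S : Subset n} (S-dd : Is2DD G S)
                 {u v : Fin n} (uv : Adj G u v) where

  open Subdivision G u v

  Dominated : Fin 3 → Fin n ⊎ Fin 3 → Set
  Dominated c = DisjDominated _~_ (Extend S c)

  u≢v : u ≢ v
  u≢v refl = contradiction (trans (sym uv) (IsSimple.irrefl simple u)) λ ()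

  kept-distanceTwo : ∀ {a y w} → a ≢ y → ¬ Adj G a y → Adj G a w → Adj G w y →
    ¬ IsUV a w → ¬ IsUV w y → AtDistanceTwo _~_ (inj₁ a) (inj₁ y)
  kept-distanceTwo a≢y ¬ay aw wy ¬uv₁ ¬uv₂ =
    (λ { refl → a≢y refl }) , (λ ay → ¬ay (~⇒Adj ay)) , inj₁ _ , Adj⇒~ aw ¬uv₁ , Adj⇒~ wy ¬uv₂

  u-edge-to-S : ∀ {y} → v ∉ S → y ∈ S → Adj G u y → inj₁ u ~ inj₁ y
  u-edge-to-S v∉S y∈S uy = Adj⇒~ uy λ { (inj₁ (_ , refl)) → v∉S y∈S ; (inj₂ (u≡v , _)) → u≢v u≡v }

  module OldVertex {a : Fin n} (a≢u : a ≢ u) (a≢v : a ≢ v) where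

    ¬IsUV-from : ∀ {w} → ¬ IsUV a w
    ¬IsUV-from (inj₁ (a≡u , _)) = a≢u a≡u
    ¬IsUV-from (inj₂ (a≡v , _)) = a≢v a≡v

    edge : ∀ {w} → Adj G a w → inj₁ a ~ inj₁ w
    edge aw = Adj⇒~ aw ¬IsUV-from

    Lost : Fin n → Set
    Lost y = (y ≡ v × Adj G a u) ⊎ (y ≡ u × Adj G a v)

    kept-or-lost : ∀ {y} → Dist2 G a y → AtDistanceTwo _~_ (inj₁ a) (inj₁ y) ⊎ Lost y
    kept-or-lost {y} (a≢y , ¬ay , w , aw , wy) with isUV? w y
    ... | yes (inj₁ (refl , refl)) = inj₂ (inj₁ (refl , aw))
    ... | yes (inj₂ (refl , refl)) = inj₂ (inj₂ (refl , aw))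
    ... | no ¬uv = inj₁ (kept-distanceTwo a≢y ¬ay aw wy ¬IsUV-from ¬uv)

    via-u : Adj G a u → AtDistanceTwo _~_ (inj₁ a) x₁
    via-u au = (λ ()) , (λ a~x₁ → a≢u (eqb⇒≡ a~x₁)) , inj₁ u , edge au , eqb-refl u

    via-v : Adj G a v → AtDistanceTwo _~_ (inj₁ a) x₃
    via-v av = (λ ()) , (λ a~x₃ → a≢v (eqb⇒≡ a~x₃)) , inj₁ v , edge av , eqb-refl v

    dominated : ∀ c → a ∉ S →
      (v ∈ S → u ∉ S → c ≡ i₁) → (u ∈ S → v ∉ S → c ≡ i₃) → Dominated c (inj₁ a)
    dominated c a∉S lost-u lost-v
      with u ∈? S ×-dec G a u Bool.≟ true | v ∈? S ×-dec G a v Bool.≟ true | S-dd a a∉S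
    ... | yes (u∈S , au) | _ | _ = inj₁ (inj₁ u , u∈S , edge au)
    ... | no _ | yes (v∈S , av) | _ = inj₁ (inj₁ v , v∈S , edge av)
    ... | no _ | no _ | inj₁ (y , y∈S , ay) = inj₁ (inj₁ y , y∈S , edge ay)
    ... | no ¬u | no ¬v | inj₂ (y , z , y≢z , y∈S , z∈S , ay , az) =
      combine (kept-or-lost ay) (kept-or-lost az)
      where
      Replacement : Set
      Replacement = ∃[ i ] (i ≡ c × AtDistanceTwo _~_ (inj₁ a) (inj₂ i))

      replace : ∀ {y} → y ∈ S → Lost y → Replacement
      replace v∈S (inj₁ (refl , au)) = i₁ , sym (lost-u v∈S λ u∈S → ¬u (u∈S , au)) , via-u au
      replace u∈S (inj₂ (refl , av)) = i₃ , sym (lost-v u∈S λ v∈S → ¬v (v∈S , av)) , via-v av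

      with-replacement : ∀ {y} → y ∈ S → AtDistanceTwo _~_ (inj₁ a) (inj₁ y) → Replacement →
        Dominated c (inj₁ a)
      with-replacement {y} y∈S ay (i , i≡c , ai) = inj₂ (inj₁ y , inj₂ i , (λ ()) , y∈S , i≡c , ay , ai)

      not-both-lost : Lost y → Lost z → ⊥
      not-both-lost (inj₁ (refl , _))  (inj₁ (refl , _))  = y≢z refl
      not-both-lost (inj₁ (refl , au)) (inj₂ (refl , _))  = ¬u (z∈S , au)
      not-both-lost (inj₂ (refl , _))  (inj₁ (refl , au)) = ¬u (y∈S , au)
      not-both-lost (inj₂ (refl , _))  (inj₂ (refl , _))  = y≢z refl

      combine : AtDistanceTwo _~_ (inj₁ a) (inj₁ y) ⊎ Lost y →
                AtDistanceTwo _~_ (inj₁ a) (inj₁ z) ⊎ Lost z → Dominated c (inj₁ a)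
      combine (inj₁ ay′) (inj₁ az′) =
        inj₂ (inj₁ y , inj₁ z , (λ { refl → y≢z refl }) , y∈S , z∈S , ay′ , az′)
      combine (inj₁ ay′) (inj₂ lz) = with-replacement y∈S ay′ (replace z∈S lz)
      combine (inj₂ ly) (inj₁ az′) = with-replacement z∈S az′ (replace y∈S ly)
      combine (inj₂ ly) (inj₂ lz) = ⊥-elim (not-both-lost ly lz)

  u-dominated-by-neighbour : ∀ c → v ∉ S → HasNeighbourIn G S u → Dominated c (inj₁ u)
  u-dominated-by-neighbour c v∉S (y , y∈S , uy) = inj₁ (inj₁ y , y∈S , u-edge-to-S v∉S y∈S uy)

  u-dominated-at-distance-two : u ∉ S → ¬ HasNeighbourIn G S u → ¬ HasNeighbourIn G S v →
    Dominated i₂ (inj₁ u)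
  u-dominated-at-distance-two u∉S ¬Nu ¬Nv with S-dd u u∉S
  ... | inj₁ Nu = contradiction Nu ¬Nu
  ... | inj₂ (y , _ , _ , y∈S , _ , (u≢y , ¬uy , w , uw , wy) , _) =
    inj₂ (x₂ , inj₁ y , (λ ()) , refl , y∈S ,
          ((λ ()) , (λ ()) , x₁ , eqb-refl u , refl) ,
          kept-distanceTwo u≢y ¬uy uw wy
            (λ { (inj₁ (_ , refl)) → ¬Nv (y , y∈S , wy) ; (inj₂ (u≡v , _)) → u≢v u≡v })
            (λ { (inj₁ (refl , _)) → contradiction (trans (sym uw) (IsSimple.irrefl simple u)) λ ()
               ; (inj₂ (refl , _)) → ¬Nv (y , y∈S , wy) }))

  x₁-dominated-at-distance-two : u ∉ S → v ∉ S → HasNeighbourIn G S u → Dominated i₃ x₁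
  x₁-dominated-at-distance-two u∉S v∉S (y , y∈S , uy) =
    inj₂ (x₃ , inj₁ y , (λ ()) , refl , y∈S ,
          ((λ ()) , (λ ()) , x₂ , refl , refl) ,
          ((λ ()) , (λ y≡u → u∉S (subst (_∈ S) (eqb⇒≡ y≡u) y∈S)) , inj₁ u , eqb-refl u ,
           u-edge-to-S v∉S y∈S uy))

  x₃-extends : v ∉ S → (u ∉ S → HasNeighbourIn G S u) → DisjDominating _~_ (Extend S i₃)
  x₃-extends v∉S Nu (inj₁ a) a∉S with a ≟ u | a ≟ v
  ... | yes refl | _        = u-dominated-by-neighbour i₃ v∉S (Nu a∉S)
  ... | no _     | yes refl = inj₁ (x₃ , refl , eqb-refl v)
  ... | no a≢u   | no a≢v   =
    OldVertex.dominated a≢u a≢v i₃ a∉S (λ v∈S → contradiction v∈S v∉S) (λ _ _ → refl)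
  x₃-extends v∉S Nu x₁ _ with u ∈? S
  ... | yes u∈S = inj₁ (inj₁ u , u∈S , eqb-refl u)
  ... | no u∉S  = x₁-dominated-at-distance-two u∉S v∉S (Nu u∉S)
  x₃-extends _ _ x₂ _     = inj₁ (x₃ , refl , refl)
  x₃-extends _ _ x₃ x₃∉ = contradiction refl x₃∉

module _ {n} {G : AdjFun n} (simple : IsSimple G) {S : Subset n} (S-dd : Is2DD G S) where

  private
    Adj-sym : ∀ {a b} → Adj G a b → Adj G b a
    Adj-sym {a} {b} ab = trans (IsSimple.sym simple b a) ab

  x₁-extends : ∀ {u v} → Adj G u v → u ∉ S → (v ∉ S → HasNeighbourIn G S v) →
    DisjDominating (Subdivision._~_ G u v) (Extend S i₁)
  x₁-extends uv u∉S Nv =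
    DisjDominating-mirror G S i₁ (Extension.x₃-extends simple S-dd (Adj-sym uv) u∉S Nv)

  x₂-extends : ∀ {u v} → Adj G u v →
    (u ∈ S × v ∈ S) ⊎ (u ∉ S × v ∉ S × ¬ HasNeighbourIn G S u × ¬ HasNeighbourIn G S v) →
    DisjDominating (Subdivision._~_ G u v) (Extend S i₂)
  x₂-extends {u} {v} uv endpoints (inj₁ a) a∉S with a ≟ u | a ≟ v | endpoints
  ... | yes refl | _ | inj₁ (u∈S , _) = contradiction u∈S a∉S
  ... | yes refl | _ | inj₂ (u∉S , _ , ¬Nu , ¬Nv) =
    Extension.u-dominated-at-distance-two simple S-dd uv u∉S ¬Nu ¬Nv
  ... | no _ | yes refl | inj₁ (_ , v∈S) = contradiction v∈S a∉S
  ... | no _ | yes refl | inj₂ (_ , v∉S , ¬Nu , ¬Nv) = DisjDominated-mirror G S i₂ (inj₁ v)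
    (Extension.u-dominated-at-distance-two simple S-dd (Adj-sym uv) v∉S ¬Nv ¬Nu)
  ... | no a≢u | no a≢v | inj₁ (u∈S , v∈S) = Extension.OldVertex.dominated simple S-dd uv a≢u a≢v
    i₂ a∉S (λ _ u∉S → contradiction u∈S u∉S) (λ _ v∉S → contradiction v∈S v∉S)
  ... | no a≢u | no a≢v | inj₂ (u∉S , v∉S , _) = Extension.OldVertex.dominated simple S-dd uv a≢u a≢v
    i₂ a∉S (λ v∈S _ → contradiction v∈S v∉S) (λ u∈S _ → contradiction u∈S u∉S)
  x₂-extends _ _ x₁ _   = inj₁ (x₂ , refl , refl)
  x₂-extends _ _ x₂ x₂∉ = contradiction refl x₂∉
  x₂-extends _ _ x₃ _   = inj₁ (x₂ , refl , refl)

  extends-by-new-vertex : ∀ {u v} → Adj G u v →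
    ∃[ c ] DisjDominating (Subdivision._~_ G u v) (Extend S c)
  extends-by-new-vertex {u} {v} uv with u ∈? S | v ∈? S
  ... | yes u∈S | yes v∈S = i₂ , x₂-extends uv (inj₁ (u∈S , v∈S))
  ... | yes u∈S | no v∉S  = i₃ , Extension.x₃-extends simple S-dd uv v∉S (λ u∉S → contradiction u∈S u∉S)
  ... | no u∉S  | yes v∈S = i₁ , x₁-extends uv u∉S (λ v∉S → contradiction v∈S v∉S)
  ... | no u∉S  | no v∉S with hasNeighbourIn? G S u | hasNeighbourIn? G S v
  ...   | yes Nu  | _       = i₃ , Extension.x₃-extends simple S-dd uv v∉S (λ _ → Nu)
  ...   | no _    | yes Nv  = i₁ , x₁-extends uv u∉S (λ _ → Nv)
  ...   | no ¬Nu  | no ¬Nv  = i₂ , x₂-extends uv (inj₂ (u∉S , v∉S , ¬Nu , ¬Nv))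

  subdivide3-2DD : ∀ {u v} → Adj G u v →
    ∃[ T ] (Is2DD (subdivide3 G u v) T × ∣ T ∣ ≡ ∣ S ∣ + 1)
  subdivide3-2DD uv with extends-by-new-vertex uv
  ... | c , dom =
    S ++ ⁅ c ⁆ ,
    DisjDominating-pullback (splitAt n) (join n 3) (splitAt-join n 3) (λ _ _ → mk⇔ id id)
      (Extend⇒∈++ S c) dom ,
    trans (∣p++q∣ S ⁅ c ⁆) (cong (∣ S ∣ +_) (∣⁅x⁆∣≡1 c))

lemma2p3 : ∀ (n : ℕ) (G : AdjFun n) → IsSimple G → Connected G →
    ∀ (u v : Fin n) → Adj G u v →
    ∀ (k : ℕ) → IsDDNumber G k → 3 * k ≤ n →
    ∀ (k' : ℕ) → IsDDNumber (subdivide3 G u v) k' → 3 * k' ≤ n + 3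
lemma2p3 n G simple _ u v uv k ((S , S-dd , ∣S∣≡k) , _) 3k≤n k' (_ , k'-minimal)
  with subdivide3-2DD simple S-dd uv
... | T , T-dd , ∣T∣≡∣S∣+1 = begin
  3 * k'      ≤⟨ *-monoʳ-≤ 3 k'≤k+1 ⟩
  3 * (k + 1) ≡⟨ *-distribˡ-+ 3 k 1 ⟩
  3 * k + 3   ≤⟨ +-monoˡ-≤ 3 3k≤n ⟩
  n + 3       ∎
  where
  open ≤-Reasoning
  k'≤k+1 : k' ≤ k + 1
  k'≤k+1 = subst (k' ≤_) (trans ∣T∣≡∣S∣+1 (cong (_+ 1) ∣S∣≡k)) (k'-minimal T T-dd)
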